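{- Let $G=(V,E)$ be an outer 1-planar graph with a fixed outer 1-planar drawing whose vertices in cyclic order along the outer boundary are $v_1,\dots,v_n$. Let $U \subset V$ be such that the induced subgraph $G[U]$ is a cycle of order $k \geq 4$. For every $u,w \in U$ such that $V(u,w) \cap U = \varnothing$, the number of vertices in $V \setminus V(u,w)$ that are adjacent to at least one vertex of $V(u,w)$ is at most three.
   Context: A graph is outer 1-planar if it can be drawn in the plane with all vertices in convex position on the outer boundary and each edge crossed at most once (drawings are simple). For vertices $v_i, v_j$ in the cyclic order, $V(v_i,v_j)$ denotes the set of vertices strictly between $v_i$ and $v_j$ when going along the cyclic order from $v_i$ to $v_j$, i.e. $v_{i+1},\dots,v_{j-1}$ (indices taken cyclically). -}

module Defs where

open import Data.Bool using (Bool; true; false; T; not; _∧_; _∨_; _xor_; if_then_else_)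
open import Data.Nat using (ℕ; zero; suc; _+_; _<ᵇ_; _≡ᵇ_; _≤_)
open import Data.Fin using (Fin; toℕ)
open import Data.List using (List; length; filterᵇ; allFin)
open import Data.Bool.ListAction using (any)
open import Data.Product using (Σ; _×_; ∃)
open import Data.Sum using (_⊎_)
open import Function.Definitions using (Injective)
open import Function.Bundles using (_⇔_)
open import Relation.Binary.PropositionalEquality using (_≡_)

-- The vertex i is the vertex
-- v_{i+1} of the paper, i.e. Fin n already lists the vertices in the
-- cyclic order of the fixed outer 1-planar drawing (convex position).
record Graph (n : ℕ) : Set where
  field
    adj     : Fin n → Fin n → Bool
    sym     : ∀ x y → adj x y ≡ adj y x
    irrefl  : ∀ x → adj x x ≡ false

open Graph public

-- cyc u w x : x ∈ V(u,w), i.e. x is strictly between u and w when going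
-- along the cyclic order from u to w (u+1, ..., w-1, indices mod n).
-- For u = w this is every vertex except u (full turn v_{i+1},...,v_{i-1}).
cyc : ∀ {n} → Fin n → Fin n → Fin n → Bool
cyc u w x =
  if toℕ u <ᵇ toℕ w then ((toℕ u <ᵇ toℕ x) ∧ (toℕ x <ᵇ toℕ w))
  else if toℕ w <ᵇ toℕ u then ((toℕ u <ᵇ toℕ x) ∨ (toℕ x <ᵇ toℕ w))
  else not (toℕ x ≡ᵇ toℕ u)

eqᵇ : ∀ {n} → Fin n → Fin n → Bool
eqᵇ x y = toℕ x ≡ᵇ toℕ y

-- The straight-line chords ab and cd (vertices in convex position) cross
-- iff their four endpoints are distinct and exactly one of c, d lies on
-- the open arc from a to b.
crossᵇ : ∀ {n} → Fin n → Fin n → Fin n → Fin n → Bool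
crossᵇ a b c d =
  not (eqᵇ a b) ∧ not (eqᵇ a c) ∧ not (eqᵇ a d) ∧
  not (eqᵇ b c) ∧ not (eqᵇ b d) ∧ not (eqᵇ c d) ∧
  (cyc a b c xor cyc a b d)

-- The drawing given by the cyclic order is outer 1-planar: every edge ab
-- is crossed by at most one edge (edges being unordered pairs).
OuterOnePlanar : ∀ {n} → Graph n → Set
OuterOnePlanar {n} G =
  ∀ (a b c d c′ d′ : Fin n) →
  T (adj G a b) → T (adj G c d) → T (adj G c′ d′) →
  T (crossᵇ a b c d) → T (crossᵇ a b c′ d′) →
  (c ≡ c′ × d ≡ d′) ⊎ (c ≡ d′ × d ≡ c′)

CycleAdj : ∀ {k} → Fin k → Fin k → Set
CycleAdj {k} i j =
  (suc (toℕ i) ≡ toℕ j) ⊎ (suc (toℕ j) ≡ toℕ i) ⊎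
  (toℕ i ≡ 0 × suc (toℕ j) ≡ k) ⊎ (toℕ j ≡ 0 × suc (toℕ i) ≡ k)

InducedCycle : ∀ {n} → Graph n → (Fin n → Bool) → ℕ → Set
InducedCycle {n} G U k =
  Σ (Fin k → Fin n) λ c →
    Injective _≡_ _≡_ c ×
    (∀ x → T (U x) ⇔ ∃ λ i → c i ≡ x) ×
    (∀ i j → T (adj G (c i) (c j)) ⇔ CycleAdj i j)

boundaryCount : ∀ {n} → Graph n → Fin n → Fin n → ℕ
boundaryCount {n} G u w =
  length (filterᵇ
    (λ x → not (cyc u w x) ∧ any (λ y → cyc u w y ∧ adj G x y) (allFin n))
    (allFin n))

-- Let C be the induced cycle and x ∉ V(u,w) ∪ {u, w} a vertex with a neighbour y ∈ V(u,w);
-- then y ∉ C.  With the vertices in convex position, the edge xy crosses the chord uw and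
-- separates u from w.  If uw is an edge, 1-planarity leaves room for only one such x, so
-- the boundary lies in {u, w, x}.  If uw is not an edge, C goes from u to w on both sides
-- of xy and so crosses it: by two different edges if x ∉ C, contradicting 1-planarity, and
-- otherwise by an edge pq of C not incident to x.  Some r ∈ {u, w} differs from p and q and
-- lies on the side of pq containing y, so pq separates x from r and is crossed by a second
-- edge of C, which 1-planarity forces to be xy, impossible as y ∉ C.
module Submission where

open import Defs
open import Data.Bool as Bool using (Bool; T; true; false; not; _∧_; _∨_; _xor_; if_then_else_)
open import Data.Bool.ListAction using (any)
open import Data.Bool.Properties using (T?; T-∧)
open import Data.Empty using (⊥; ⊥-elim)
open import Data.Fin using (Fin; zero; suc; toℕ)
open import Data.Fin.Properties using (toℕ-injective; toℕ-fromℕ<; toℕ<n) renaming (_≟_ to _≟ᶠ_)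
open import Data.List using ([]; _∷_; length; filterᵇ; allFin)
open import Data.List.Properties using (filter-none)
open import Data.List.Relation.Binary.Sublist.Propositional using (⊆-refl)
open import Data.List.Relation.Binary.Sublist.Propositional.Properties using (filter⁺; length-mono-≤)
open import Data.List.Relation.Unary.All as All using ()
open import Data.List.Relation.Unary.AllPairs using ([]; _∷_)
open import Data.List.Relation.Unary.Any using (satisfied)
open import Data.List.Relation.Unary.Any.Properties using (any⁻)
open import Data.List.Relation.Unary.Unique.Propositional using (Unique)
open import Data.List.Relation.Unary.Unique.Propositional.Properties using (allFin⁺)
open import Data.Nat
  using (ℕ; zero; suc; >-nonZero; _+_; _*_; _≤_; _<_; _<ᵇ_; _≡ᵇ_; _<?_; NonZero; z≤n; s≤s; _%_; _/_)
open import Data.Nat.DivMod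
  using (_mod_; m≡m%n+[m/n]*n; m%n<n; [m+n]%n≡m%n; [m+kn]%n≡m%n; m%n%n≡m%n; %-distribˡ-+; m<n⇒m%n≡m; n%n≡0)
open import Data.Nat.Properties
open import Data.Product using (_×_; _,_; ∃; proj₁; proj₂)
open import Data.Sum using (_⊎_; inj₁; inj₂; [_,_]′)
open import Data.Vec using (Vec; []; _∷_; lookup; map; count)
open import Data.Vec.Properties using (lookup-map; count≤n)
open import Function using (_∘_)
open import Function.Bundles using (_⇔_; mk⇔; Equivalence)
open import Function.Definitions using (Injective)
open import Relation.Binary using (tri<; tri≈; tri>; DecidableEquality)
open import Relation.Binary.PropositionalEquality as ≡ using (_≡_; _≢_; refl; cong; subst; subst₂)
open import Relation.Nullary using (¬_; Dec; yes; no)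
open import Relation.Nullary.Decidable using (True; toWitness; toWitnessFalse; map′; ⌊_⌋)

T-from : ∀ {b} → b ≡ true → T b
T-from refl = _

T-not⁻ : ∀ {b} → T (not b) → ¬ T b
T-not⁻ {true} ()

T-not : ∀ {b} → ¬ T b → T (not b)
T-not {false} _  = _
T-not {true}  ¬t = ¬t _

infixr 4 _,ᵀ_
_,ᵀ_ : ∀ {a b} → T a → T b → T (a ∧ b)
_,ᵀ_ {true} _ tb = tb

⇒-elim : ∀ {a b} → T (not a ∨ b) → T a → T b
⇒-elim {true} tb _ = tb

T-xor⇒≢ : ∀ {a b} → T (a xor b) → a ≢ b
T-xor⇒≢ {true}  {false} _ ()
T-xor⇒≢ {false} {true}  _ ()

≢⇒T-xor : ∀ {a b} → a ≢ b → T (a xor b)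
≢⇒T-xor {true}  {true}  a≢b = a≢b refl
≢⇒T-xor {true}  {false} _   = _
≢⇒T-xor {false} {true}  _   = _
≢⇒T-xor {false} {false} a≢b = a≢b refl

T-not-xor⇒≡ : ∀ {a b} → T (not (a xor b)) → a ≡ b
T-not-xor⇒≡ {true}  {true}  _ = refl
T-not-xor⇒≡ {false} {false} _ = refl

T-not-eqᵇ : ∀ {n} {a b : Fin n} → a ≢ b → T (not (eqᵇ a b))
T-not-eqᵇ {a = a} {b} a≢b = T-not (a≢b ∘ toℕ-injective ∘ ≡ᵇ⇒≡ (toℕ a) (toℕ b))

-- Deciding statements about the cyclic order of m points

cycℕ : ℕ → ℕ → ℕ → Bool
cycℕ a b x =
  if a <ᵇ b then ((a <ᵇ x) ∧ (x <ᵇ b))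
  else if b <ᵇ a then ((a <ᵇ x) ∨ (x <ᵇ b))
  else not (x ≡ᵇ a)

infixr 4 _⇒ᶠ_
infixr 5 _∧ᶠ_ _xorᶠ_
infix 6 ¬ᶠ_

data Formula (m : ℕ) : Set where
  between : (a b x : Fin m) → Formula m
  equal : (a b : Fin m) → Formula m
  ¬ᶠ_ : Formula m → Formula m
  _∧ᶠ_ _xorᶠ_ _⇒ᶠ_ : Formula m → Formula m → Formula m

-- At a vector of toℕ-values of points this reduces, definitionally, to the corresponding
-- expression in cyc and eqᵇ, which is how the decided facts below are applied.
⟦_⟧ : ∀ {m} → Formula m → Vec ℕ m → Bool
⟦ between a b x ⟧ z = cycℕ (lookup z a) (lookup z b) (lookup z x)
⟦ equal a b ⟧     z = lookup z a ≡ᵇ lookup z b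
⟦ ¬ᶠ φ ⟧          z = not (⟦ φ ⟧ z)
⟦ φ ∧ᶠ ψ ⟧        z = ⟦ φ ⟧ z ∧ ⟦ ψ ⟧ z
⟦ φ xorᶠ ψ ⟧      z = ⟦ φ ⟧ z xor ⟦ ψ ⟧ z
⟦ φ ⇒ᶠ ψ ⟧        z = not (⟦ φ ⟧ z) ∨ ⟦ ψ ⟧ z

crossing : ∀ {m} (a b c d : Fin m) → Formula m
crossing a b c d =
  ¬ᶠ equal a b ∧ᶠ ¬ᶠ equal a c ∧ᶠ ¬ᶠ equal a d ∧ᶠ ¬ᶠ equal b c ∧ᶠ ¬ᶠ equal b d ∧ᶠ ¬ᶠ equal c d ∧ᶠ
  (between a b c xorᶠ between a b d)

SameOrder : ∀ {m} → Vec ℕ m → Vec ℕ m → Set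
SameOrder z z′ = ∀ i j → lookup z i < lookup z j ⇔ lookup z′ i < lookup z′ j

<ᵇ-cong : ∀ {a b c d} → (a < b ⇔ c < d) → (a <ᵇ b) ≡ (c <ᵇ d)
<ᵇ-cong {a} {b} {c} {d} a<b⇔c<d with a <ᵇ b in p | c <ᵇ d in q
... | false | false = refl
... | true  | true  = refl
... | true  | false = ⊥-elim (subst T q (<⇒<ᵇ (Equivalence.to a<b⇔c<d (<ᵇ⇒< a b (T-from p)))))
... | false | true  = ⊥-elim (subst T p (<⇒<ᵇ (Equivalence.from a<b⇔c<d (<ᵇ⇒< c d (T-from q)))))

≡ᵇ-via-<ᵇ : ∀ a b → (a ≡ᵇ b) ≡ not ((a <ᵇ b) ∨ (b <ᵇ a))
≡ᵇ-via-<ᵇ zero    zero    = refl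
≡ᵇ-via-<ᵇ zero    (suc b) = refl
≡ᵇ-via-<ᵇ (suc a) zero    = refl
≡ᵇ-via-<ᵇ (suc a) (suc b) = ≡ᵇ-via-<ᵇ a b

⟦⟧-invariant : ∀ {m} (φ : Formula m) {z z′} → SameOrder z z′ → ⟦ φ ⟧ z ≡ ⟦ φ ⟧ z′
⟦⟧-invariant (between a b x) {z} {z′} same
  rewrite <ᵇ-cong (same a b) | <ᵇ-cong (same b a) | <ᵇ-cong (same a x) | <ᵇ-cong (same x b)
        | ≡ᵇ-via-<ᵇ (lookup z x) (lookup z a) | ≡ᵇ-via-<ᵇ (lookup z′ x) (lookup z′ a)
        | <ᵇ-cong (same x a) | <ᵇ-cong (same a x) = refl
⟦⟧-invariant (equal a b) {z} {z′} same
  rewrite ≡ᵇ-via-<ᵇ (lookup z a) (lookup z b) | ≡ᵇ-via-<ᵇ (lookup z′ a) (lookup z′ b)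
        | <ᵇ-cong (same a b) | <ᵇ-cong (same b a) = refl
⟦⟧-invariant (¬ᶠ φ)     same = cong not (⟦⟧-invariant φ same)
⟦⟧-invariant (φ ∧ᶠ ψ)   same = ≡.cong₂ _∧_ (⟦⟧-invariant φ same) (⟦⟧-invariant ψ same)
⟦⟧-invariant (φ xorᶠ ψ) same = ≡.cong₂ _xor_ (⟦⟧-invariant φ same) (⟦⟧-invariant ψ same)
⟦⟧-invariant (φ ⇒ᶠ ψ)   same = ≡.cong₂ (λ a b → not a ∨ b) (⟦⟧-invariant φ same) (⟦⟧-invariant ψ same)

rank : ∀ {m} → Vec ℕ m → ℕ → ℕ
rank z x = count (_<? x) z

rank-mono : ∀ {m} (z : Vec ℕ m) {x y} → x ≤ y → rank z x ≤ rank z y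
rank-mono []      x≤y = z≤n
rank-mono (v ∷ z) {x} {y} x≤y with v <ᵇ x in p | v <ᵇ y in q
... | true  | true  = s≤s (rank-mono z x≤y)
... | false | true  = m≤n⇒m≤1+n (rank-mono z x≤y)
... | false | false = rank-mono z x≤y
... | true  | false = ⊥-elim (subst T q (<⇒<ᵇ (<-≤-trans (<ᵇ⇒< v x (T-from p)) x≤y)))

rank-strict : ∀ {m} (z : Vec ℕ m) i {y} → lookup z i < y → rank z (lookup z i) < rank z y
rank-strict (v ∷ z) zero {y} v<y with v <ᵇ v in p | v <ᵇ y in q
... | true  | _     = ⊥-elim (<-irrefl refl (<ᵇ⇒< v v (T-from p)))
... | false | false = ⊥-elim (subst T q (<⇒<ᵇ v<y))
... | false | true  = s≤s (rank-mono z (<⇒≤ v<y))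
rank-strict (v ∷ z) (suc i) {y} x<y with v <ᵇ lookup z i in p | v <ᵇ y in q
... | true  | true  = s≤s (rank-strict z i x<y)
... | false | true  = m≤n⇒m≤1+n (rank-strict z i x<y)
... | false | false = rank-strict z i x<y
... | true  | false = ⊥-elim (subst T q (<⇒<ᵇ (<-trans (<ᵇ⇒< v _ (T-from p)) x<y)))

rank-same-order : ∀ {m} (z : Vec ℕ m) → SameOrder z (map (rank z) z)
rank-same-order z i j rewrite lookup-map i (rank z) z | lookup-map j (rank z) z =
  mk⇔ (rank-strict z i) reflect
  where
    reflect : rank z (lookup z i) < rank z (lookup z j) → lookup z i < lookup z j
    reflect r< with lookup z i <? lookup z j
    ... | yes zi<zj = zi<zj
    ... | no  zi≮zj = ⊥-elim (<⇒≱ r< (rank-mono z (≮⇒≥ zi≮zj)))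

Bounded : ∀ {m} → ℕ → Vec ℕ m → Set
Bounded b v = ∀ i → lookup v i < b

rank-bounded : ∀ {m} (z : Vec ℕ m) → Bounded m (map (rank z) z)
rank-bounded z i rewrite lookup-map i (rank z) z =
  <-≤-trans (rank-strict z i (n<1+n _)) (count≤n (_<? suc (lookup z i)) z)

allBounded? : ∀ b m {P : Vec ℕ m → Set} → (∀ v → Dec (P v)) → Dec (∀ v → Bounded b v → P v)
allBounded? b zero    {P} P? = map′ (λ p → λ { [] _ → p }) (λ h → h [] (λ ())) (P? [])
allBounded? b (suc m) {P} P? = map′ to from (allUpTo? (λ x → allBounded? b m (λ v → P? (x ∷ v))) b)
  where
    to : (∀ {x} → x < b → ∀ v → Bounded b v → P (x ∷ v)) → ∀ v → Bounded b v → P v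
    to h (x ∷ v) bounded = h (bounded zero) v (bounded ∘ suc)
    from : (∀ v → Bounded b v → P v) → ∀ {x} → x < b → ∀ v → Bounded b v → P (x ∷ v)
    from h x<b v bounded = h (_ ∷ v) λ { zero → x<b ; (suc i) → bounded i }

Valid : ∀ {m} → Formula m → Set
Valid φ = ∀ z → T (⟦ φ ⟧ z)

valid? : ∀ {m} (φ : Formula m) → Dec (∀ v → Bounded m v → T (⟦ φ ⟧ v))
valid? {m} φ = allBounded? m m (λ v → T? (⟦ φ ⟧ v))

-- Truth depends only on the order type of the m values, and ranking them realises that
-- order type inside {0, …, m - 1}, so an exhaustive check over Bounded m vectors suffices.
decide : ∀ {m} (φ : Formula m) → {True (valid? φ)} → Valid φ
decide φ {ok} z =
  subst T (≡.sym (⟦⟧-invariant φ (rank-same-order z))) (toWitness ok (map (rank z) z) (rank-bounded z))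

-- Chords of points in convex position

crossᵇ-intro : ∀ {n} {a b c d : Fin n} → a ≢ b → a ≢ c → a ≢ d → b ≢ c → b ≢ d → c ≢ d →
  cyc a b c ≢ cyc a b d → T (crossᵇ a b c d)
crossᵇ-intro a≢b a≢c a≢d b≢c b≢d c≢d sides =
  T-not-eqᵇ a≢b ,ᵀ T-not-eqᵇ a≢c ,ᵀ T-not-eqᵇ a≢d ,ᵀ T-not-eqᵇ b≢c ,ᵀ T-not-eqᵇ b≢d ,ᵀ
  T-not-eqᵇ c≢d ,ᵀ ≢⇒T-xor sides

module _ {n : ℕ} where

  private
    v₀ : ∀ {m} → Fin (1 + m)
    v₀ = zero
    v₁ : ∀ {m} → Fin (2 + m)
    v₁ = suc v₀
    v₂ : ∀ {m} → Fin (3 + m)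
    v₂ = suc v₁
    v₃ : ∀ {m} → Fin (4 + m)
    v₃ = suc v₂
    v₄ : ∀ {m} → Fin (5 + m)
    v₄ = suc v₃

    same-side : Fin 5 → Formula 5
    same-side r = ¬ᶠ between v₀ v₁ v₃ ∧ᶠ ¬ᶠ between v₀ v₁ v₄ ∧ᶠ between v₀ v₁ v₂ ∧ᶠ
                  ¬ᶠ equal v₃ v₄ ∧ᶠ ¬ᶠ equal r v₃ ∧ᶠ ¬ᶠ equal r v₄
                  ⇒ᶠ ¬ᶠ (between v₃ v₄ v₂ xorᶠ between v₃ v₄ r)

  cyc-full-turn : ∀ {u z : Fin n} → z ≢ u → T (cyc u u z)
  cyc-full-turn {u} {z} z≢u =
    ⇒-elim (decide (¬ᶠ equal v₁ v₀ ⇒ᶠ between v₀ v₀ v₁) (toℕ u ∷ toℕ z ∷ [])) (T-not-eqᵇ z≢u)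

  crossᵇ-sym : ∀ {a b c d : Fin n} → T (crossᵇ a b c d) → T (crossᵇ c d a b)
  crossᵇ-sym {a} {b} {c} {d} =
    ⇒-elim (decide (crossing v₀ v₁ v₂ v₃ ⇒ᶠ crossing v₂ v₃ v₀ v₁) (toℕ a ∷ toℕ b ∷ toℕ c ∷ toℕ d ∷ []))

  crossᵇ-separates : ∀ {a b c d : Fin n} → T (crossᵇ a b c d) → cyc a b c ≢ cyc a b d
  crossᵇ-separates {a} {b} {c} {d} =
    T-xor⇒≢ ∘ ⇒-elim (decide (crossing v₀ v₁ v₂ v₃ ⇒ᶠ between v₀ v₁ v₂ xorᶠ between v₀ v₁ v₃)
                             (toℕ a ∷ toℕ b ∷ toℕ c ∷ toℕ d ∷ []))

  leaving-arc-crosses : ∀ {u w x y : Fin n} → T (cyc u w y) → ¬ T (cyc u w x) →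
    u ≢ w → x ≢ u → x ≢ w → T (crossᵇ u w x y)
  leaving-arc-crosses {u} {w} {x} {y} y∈ x∉ u≢w x≢u x≢w =
    ⇒-elim (decide φ (toℕ u ∷ toℕ w ∷ toℕ x ∷ toℕ y ∷ []))
      (y∈ ,ᵀ T-not x∉ ,ᵀ T-not-eqᵇ u≢w ,ᵀ T-not-eqᵇ x≢u ,ᵀ T-not-eqᵇ x≢w)
    where
      φ : Formula 4
      φ = between v₀ v₁ v₃ ∧ᶠ ¬ᶠ between v₀ v₁ v₂ ∧ᶠ
          ¬ᶠ equal v₀ v₁ ∧ᶠ ¬ᶠ equal v₂ v₀ ∧ᶠ ¬ᶠ equal v₂ v₁
          ⇒ᶠ crossing v₀ v₁ v₂ v₃

  arc-same-side : ∀ {u w y p q r : Fin n} → r ≡ u ⊎ r ≡ w →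
    ¬ T (cyc u w p) → ¬ T (cyc u w q) → T (cyc u w y) → p ≢ q → r ≢ p → r ≢ q →
    cyc p q y ≡ cyc p q r
  arc-same-side {u} {w} {y} {p} {q} (inj₁ refl) p∉ q∉ y∈ p≢q r≢p r≢q =
    T-not-xor⇒≡ (⇒-elim (decide (same-side v₀) (toℕ u ∷ toℕ w ∷ toℕ y ∷ toℕ p ∷ toℕ q ∷ []))
      (T-not p∉ ,ᵀ T-not q∉ ,ᵀ y∈ ,ᵀ T-not-eqᵇ p≢q ,ᵀ T-not-eqᵇ r≢p ,ᵀ T-not-eqᵇ r≢q))
  arc-same-side {u} {w} {y} {p} {q} (inj₂ refl) p∉ q∉ y∈ p≢q r≢p r≢q =
    T-not-xor⇒≡ (⇒-elim (decide (same-side v₁) (toℕ u ∷ toℕ w ∷ toℕ y ∷ toℕ p ∷ toℕ q ∷ []))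
      (T-not p∉ ,ᵀ T-not q∉ ,ᵀ y∈ ,ᵀ T-not-eqᵇ p≢q ,ᵀ T-not-eqᵇ r≢p ,ᵀ T-not-eqᵇ r≢q))

-- Walking around a cycle

SideChange : (ℕ → Bool) → ℕ → Set
SideChange F t = F t ≢ F (suc t)

side-change : ∀ (F : ℕ → Bool) {a b} → a ≤ b → F a ≢ F b → ∃ λ t → a ≤ t × t < b × SideChange F t
side-change F {b = zero} z≤n Fa≢Fb = ⊥-elim (Fa≢Fb refl)
side-change F {a} {suc b} a≤1+b Fa≢Fb with m≤n⇒m<n∨m≡n a≤1+b
... | inj₂ refl = ⊥-elim (Fa≢Fb refl)
... | inj₁ (s≤s a≤b) with F b Bool.≟ F (suc b)
...   | no change = b , a≤b , ≤-refl , change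
...   | yes Fb≡Fb+1 with side-change F a≤b (λ Fa≡Fb → Fa≢Fb (≡.trans Fa≡Fb Fb≡Fb+1))
...     | t , a≤t , t<b , change = t , a≤t , m≤n⇒m≤1+n t<b , change

side-change-inside : ∀ (F : ℕ → Bool) {j h a b} → j < a → a < h → j < b → b < h → F a ≢ F b →
  ∃ λ t → j < t × suc t < h × SideChange F t
side-change-inside F {a = a} {b} j<a a<h j<b b<h Fa≢Fb with ≤-total a b
... | inj₁ a≤b = let t , a≤t , t<b , change = side-change F a≤b Fa≢Fb
                 in t , <-≤-trans j<a a≤t , <-≤-trans (s≤s t<b) b<h , change
... | inj₂ b≤a = let t , b≤t , t<a , change = side-change F b≤a (λ Fb≡Fa → Fa≢Fb (≡.sym Fb≡Fa))
                 in t , <-≤-trans j<b b≤t , <-≤-trans (s≤s t<a) a<h , change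

module Modular (k : ℕ) .{{_ : NonZero k}} where

  infix 4 _≋_
  _≋_ : ℕ → ℕ → Set
  s ≋ t = s % k ≡ t % k

  ≋-window : ∀ {s t} → s < t → t < s + k → ¬ t ≋ s
  ≋-window {s} {t} s<t t<s+k t≋s = <⇒≱ t<s+k s+k≤t
    where
      open ≤-Reasoning
      s≡ : s ≡ s % k + s / k * k
      s≡ = m≡m%n+[m/n]*n s k
      t≡ : t ≡ s % k + t / k * k
      t≡ = ≡.trans (m≡m%n+[m/n]*n t k) (cong (_+ t / k * k) t≋s)
      s/k<t/k : s / k < t / k
      s/k<t/k = *-cancelʳ-< k (s / k) (t / k) (+-cancelˡ-< (s % k) _ _ (subst₂ _<_ s≡ t≡ s<t))
      s+k≤t : s + k ≤ t
      s+k≤t = begin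
        s + k                    ≡⟨ cong (_+ k) s≡ ⟩
        s % k + s / k * k + k    ≡⟨ +-assoc (s % k) _ k ⟩
        s % k + (s / k * k + k)  ≡⟨ cong (s % k +_) (+-comm _ k) ⟩
        s % k + suc (s / k) * k  ≤⟨ +-monoʳ-≤ (s % k) (*-monoˡ-≤ k s/k<t/k) ⟩
        s % k + t / k * k        ≡⟨ ≡.sym t≡ ⟩
        t                        ∎

  ≋-shift : ∀ a q → a + q * k ≋ a
  ≋-shift a q = [m+kn]%n≡m%n a q k

  suc-≋ : ∀ {s t} → s ≋ t → suc s ≋ suc t
  suc-≋ {s} {t} s≋t = begin
    (1 + s) % k           ≡⟨ %-distribˡ-+ 1 s k ⟩
    (1 % k + s % k) % k   ≡⟨ cong (λ r → (1 % k + r) % k) s≋t ⟩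
    (1 % k + t % k) % k   ≡⟨ ≡.sym (%-distribˡ-+ 1 t k) ⟩
    (1 + t) % k           ∎
    where open ≡.≡-Reasoning

  ≋-lift-< : ∀ {i j} → i < k → j < k → i ≢ j → ∃ λ a → a ≋ i × j < a × a < j + k
  ≋-lift-< {i} {j} i<k j<k i≢j with <-cmp i j
  ... | tri< i<j _ _ = i + k , [m+n]%n≡m%n i k , <-≤-trans j<k (m≤n+m k i) , +-monoˡ-< k i<j
  ... | tri≈ _ i≡j _ = ⊥-elim (i≢j i≡j)
  ... | tri> _ _ j<i = i , refl , j<i , <-≤-trans i<k (m≤n+m k j)

  ≋-lift : ∀ i j → ¬ i ≋ j → ∃ λ a → a ≋ i × j < a × a < j + k
  ≋-lift i j i≉j with ≋-lift-< (m%n<n i k) (m%n<n j k) i≉j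
  ... | a , a≋i , j%k<a , a<j%k+k =
    a + j / k * k , ≡.trans (≋-shift a (j / k)) (≡.trans a≋i (m%n%n≡m%n i k)) , j<a′ , a′<j+k
    where
      open ≤-Reasoning
      j≡ : j ≡ j % k + j / k * k
      j≡ = m≡m%n+[m/n]*n j k
      j<a′ : j < a + j / k * k
      j<a′ = begin-strict
        j                  ≡⟨ j≡ ⟩
        j % k + j / k * k  <⟨ +-monoˡ-< (j / k * k) j%k<a ⟩
        a + j / k * k      ∎
      a′<j+k : a + j / k * k < j + k
      a′<j+k = begin-strict
        a + j / k * k            <⟨ +-monoˡ-< (j / k * k) a<j%k+k ⟩
        j % k + k + j / k * k    ≡⟨ +-assoc (j % k) k _ ⟩
        j % k + (k + j / k * k)  ≡⟨ cong (j % k +_) (+-comm k _) ⟩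
        j % k + (j / k * k + k)  ≡⟨ +-assoc (j % k) _ k ⟨
        j % k + j / k * k + k    ≡⟨ cong (_+ k) j≡ ⟨
        j + k                    ∎

  Periodic : (ℕ → Bool) → Set
  Periodic F = ∀ {s t} → s ≋ t → F s ≡ F t

  two-side-changes : ∀ {F} → Periodic F → ∀ {a b} → ¬ a ≋ b → F a ≢ F b →
    ∃ λ t₁ → ∃ λ t₂ → ¬ t₁ ≋ t₂ × SideChange F t₁ × SideChange F t₂
  two-side-changes {F} periodic {a} {b} a≉b Fa≢Fb with ≋-lift b a (λ b≋a → a≉b (≡.sym b≋a))
  ... | b′ , b′≋b , a<b′ , b′<a+k
    with side-change F (<⇒≤ a<b′) (λ Fa≡Fb′ → Fa≢Fb (≡.trans Fa≡Fb′ (periodic b′≋b)))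
       | side-change F (<⇒≤ b′<a+k)
           (λ Fb′≡Fa+k → Fa≢Fb (≡.trans (periodic (≡.sym ([m+n]%n≡m%n a k)))
                                  (≡.trans (≡.sym Fb′≡Fa+k) (periodic b′≋b))))
  ... | t₁ , a≤t₁ , t₁<b′ , change₁ | t₂ , b′≤t₂ , t₂<a+k , change₂ =
    t₁ , t₂ , (λ t₁≋t₂ → ≋-window (<-≤-trans t₁<b′ b′≤t₂) (<-≤-trans t₂<a+k (+-monoˡ-≤ k a≤t₁)) (≡.sym t₁≋t₂)) ,
    change₁ , change₂

  side-change-avoiding-point : ∀ {F} → Periodic F → ∀ {a b} j → ¬ a ≋ j → ¬ b ≋ j → F a ≢ F b →
    ∃ λ t → ¬ t ≋ j × ¬ suc t ≋ j × SideChange F t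
  side-change-avoiding-point {F} periodic {a} {b} j a≉j b≉j Fa≢Fb
    with ≋-lift a j a≉j | ≋-lift b j b≉j
  ... | a′ , a′≋a , j<a′ , a′<j+k | b′ , b′≋b , j<b′ , b′<j+k
    with side-change-inside F j<a′ a′<j+k j<b′ b′<j+k
           (λ Fa′≡Fb′ → Fa≢Fb (≡.trans (periodic (≡.sym a′≋a)) (≡.trans Fa′≡Fb′ (periodic b′≋b))))
  ... | t , j<t , t+1<j+k , change =
    t , ≋-window j<t (<-trans (n<1+n t) t+1<j+k) , ≋-window (m<n⇒m<1+n j<t) t+1<j+k , change

  OffEdge : ℕ → ℕ → Set
  OffEdge j s = ¬ s ≋ j × ¬ s ≋ suc j

  side-change-avoiding-edge : ∀ {F} → Periodic F → ∀ {a b} j → OffEdge j a → OffEdge j b → F a ≢ F b →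
    ∃ λ t → OffEdge j t × OffEdge j (suc t) × SideChange F t
  side-change-avoiding-edge {F} periodic {a} {b} j (a≉j , a≉j+1) (b≉j , b≉j+1) Fa≢Fb
    with ≋-lift a j a≉j | ≋-lift b j b≉j
  ... | a′ , a′≋a , j<a′ , a′<j+k | b′ , b′≋b , j<b′ , b′<j+k
    with side-change-inside F (above a′≋a a≉j+1 j<a′) a′<j+k (above b′≋b b≉j+1 j<b′) b′<j+k
           (λ Fa′≡Fb′ → Fa≢Fb (≡.trans (periodic (≡.sym a′≋a)) (≡.trans Fa′≡Fb′ (periodic b′≋b))))
    where
      above : ∀ {c c′} → c′ ≋ c → ¬ c ≋ suc j → j < c′ → suc j < c′
      above c′≋c c≉j+1 j<c′ = ≤∧≢⇒< j<c′ (λ j+1≡c′ → c≉j+1 (≡.trans (≡.sym c′≋c) (cong (_% k) (≡.sym j+1≡c′))))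
  ... | t , j+1<t , t+1<j+k , change =
    t , (≋-window j<t t<j+k , ≋-window j+1<t (m<n⇒m<1+n t<j+k)) ,
    (≋-window (m<n⇒m<1+n j<t) t+1<j+k , ≋-window (s≤s j<t) (m<n⇒m<1+n t+1<j+k)) , change
    where
      j<t : j < t
      j<t = <-trans (n<1+n j) j+1<t
      t<j+k : t < j + k
      t<j+k = <-trans (n<1+n t) t+1<j+k

  edge-not-reversed : 3 ≤ k → ∀ {s t} → s ≋ suc t → suc s ≋ t → ⊥
  edge-not-reversed 3≤k {s} {t} s≋t+1 s+1≋t =
    ≋-window (m<n⇒m<1+n (n<1+n t)) (subst (_≤ t + k) (+-comm t 3) (+-monoʳ-≤ t 3≤k))
      (≡.trans (suc-≋ (≡.sym s≋t+1)) s+1≋t)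

  toℕ-mod : ∀ t → toℕ (t mod k) ≡ t % k
  toℕ-mod t = toℕ-fromℕ< (m%n<n t k)

  mod-cong : ∀ {s t} → s ≋ t → s mod k ≡ t mod k
  mod-cong {s} {t} s≋t = toℕ-injective (≡.trans (toℕ-mod s) (≡.trans s≋t (≡.sym (toℕ-mod t))))

  suc-% : ∀ t → suc (t % k) ≡ suc t % k ⊎ (suc t % k ≡ 0 × suc (t % k) ≡ k)
  suc-% t with m≤n⇒m<n∨m≡n (m%n<n t k)
  ... | inj₁ t%k+1<k = inj₁ (≡.trans (≡.sym (m<n⇒m%n≡m t%k+1<k)) t%k+1≋t+1)
    where
      t%k+1≋t+1 : suc (t % k) ≋ suc t
      t%k+1≋t+1 = suc-≋ (m%n%n≡m%n t k)
  ... | inj₂ t%k+1≡k = inj₂ (≡.trans (≡.sym (suc-≋ (m%n%n≡m%n t k)))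
                              (≡.trans (cong (_% k) t%k+1≡k) (n%n≡0 k)) , t%k+1≡k)

length-filterᵇ-∨ : ∀ {A : Set} (P Q : A → Bool) xs →
  length (filterᵇ (λ x → P x ∨ Q x) xs) ≤ length (filterᵇ P xs) + length (filterᵇ Q xs)
length-filterᵇ-∨ P Q []       = z≤n
length-filterᵇ-∨ P Q (x ∷ xs) with P x | Q x | length-filterᵇ-∨ P Q xs
... | true  | true  | ih = s≤s (≤-trans ih (+-monoʳ-≤ _ (n≤1+n _)))
... | true  | false | ih = s≤s ih
... | false | true  | ih = ≤-trans (s≤s ih) (≤-reflexive (≡.sym (+-suc _ _)))
... | false | false | ih = ih

length-filterᵇ-mono : ∀ {A : Set} {P Q : A → Bool} → (∀ {x} → T (P x) → T (Q x)) → ∀ xs →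
  length (filterᵇ P xs) ≤ length (filterᵇ Q xs)
length-filterᵇ-mono {P = P} {Q} P⇒Q xs =
  length-mono-≤ (filter⁺ (T? ∘ P) (T? ∘ Q) (λ { refl → P⇒Q }) (⊆-refl {x = xs}))

length-filterᵇ-≤1 : ∀ {A : Set} {P : A → Bool} {xs} → Unique xs →
  (∀ {x y} → T (P x) → T (P y) → x ≡ y) → length (filterᵇ P xs) ≤ 1
length-filterᵇ-≤1 [] _ = z≤n
length-filterᵇ-≤1 {P = P} {x ∷ xs} (x≢xs ∷ unique) P-unique with P x in Px
... | false = length-filterᵇ-≤1 unique P-unique
... | true  = s≤s (≤-reflexive (cong length
  (filter-none (T? ∘ P) (All.map (λ x≢y Py → x≢y (P-unique (T-from Px) Py)) x≢xs))))

length-filterᵇ-remove : ∀ {A : Set} (_≟_ : DecidableEquality A) {xs} → Unique xs → ∀ (P : A → Bool) a →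
  length (filterᵇ P xs) ≤ 1 + length (filterᵇ (λ x → P x ∧ not ⌊ x ≟ a ⌋) xs)
length-filterᵇ-remove _≟_ {xs} unique P a =
  ≤-trans (length-filterᵇ-mono split xs)
    (≤-trans (length-filterᵇ-∨ (λ x → ⌊ x ≟ a ⌋) _ xs)
      (+-monoˡ-≤ _ (length-filterᵇ-≤1 unique λ x≡a y≡a → ≡.trans (toWitness x≡a) (≡.sym (toWitness y≡a)))))
  where
    split : ∀ {x} → T (P x) → T (⌊ x ≟ a ⌋ ∨ (P x ∧ not ⌊ x ≟ a ⌋))
    split {x} Px with x ≟ a
    ... | yes _ = _
    ... | no  _ = Px ,ᵀ _

adj⇒≢ : ∀ {n} (G : Graph n) {a b} → T (adj G a b) → a ≢ b
adj⇒≢ G {a} a~a refl = subst T (irrefl G a) a~a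

module InducedCycleArc {n} (G : Graph n) (one-planar : OuterOnePlanar G) (U : Fin n → Bool)
  (k : ℕ) .{{_ : NonZero k}} (3≤k : 3 ≤ k) (c : Fin k → Fin n) (c-injective : Injective _≡_ _≡_ c)
  (c-onto : ∀ x → T (U x) ⇔ ∃ λ i → c i ≡ x) (c-adj : ∀ i j → T (adj G (c i) (c j)) ⇔ CycleAdj i j)
  where

  open Modular k

  -- Positions along the cycle are natural numbers read modulo k.  vertex is opaque so that
  -- vertex t stays neutral; otherwise the implicit points of the crossing lemmas below
  -- cannot be inferred.
  opaque
    vertex : ℕ → Fin n
    vertex t = c (t mod k)

    vertex-cong : ∀ {s t} → s ≋ t → vertex s ≡ vertex t
    vertex-cong = cong c ∘ mod-cong

    vertex-injective : ∀ {s t} → vertex s ≡ vertex t → s ≋ t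
    vertex-injective {s} {t} e = ≡.trans (≡.sym (toℕ-mod s)) (≡.trans (cong toℕ (c-injective e)) (toℕ-mod t))

    vertex-∈U : ∀ t → T (U (vertex t))
    vertex-∈U t = Equivalence.from (c-onto (vertex t)) (t mod k , refl)

    ∈U⇒vertex : ∀ {z} → T (U z) → ∃ λ t → vertex t ≡ z
    ∈U⇒vertex {z} z∈U with Equivalence.to (c-onto z) z∈U
    ... | i , ci≡z = toℕ i , ≡.trans (cong c (toℕ-injective (≡.trans (toℕ-mod (toℕ i)) (m<n⇒m%n≡m (toℕ<n i))))) ci≡z

    vertex-adjacent : ∀ t → T (adj G (vertex t) (vertex (suc t)))
    vertex-adjacent t = Equivalence.from (c-adj (t mod k) (suc t mod k)) cycle-adj
      where
        cycle-adj : CycleAdj (t mod k) (suc t mod k)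
        cycle-adj rewrite toℕ-mod t | toℕ-mod (suc t) with suc-% t
        ... | inj₁ next           = inj₁ next
        ... | inj₂ (wrap , last) = inj₂ (inj₂ (inj₂ (wrap , last)))

  ∉U⇒≢vertex : ∀ {z} → ¬ T (U z) → ∀ {t} → z ≢ vertex t
  ∉U⇒≢vertex z∉U {t} refl = z∉U (vertex-∈U t)

  sides-periodic : ∀ a b → Periodic (λ s → cyc a b (vertex s))
  sides-periodic a b = cong (cyc a b) ∘ vertex-cong

  side-change-crosses : ∀ {a b t} → a ≢ b → a ≢ vertex t → a ≢ vertex (suc t) →
    b ≢ vertex t → b ≢ vertex (suc t) → SideChange (λ s → cyc a b (vertex s)) t →
    T (crossᵇ a b (vertex t) (vertex (suc t)))
  side-change-crosses {t = t} a≢b a≢p a≢q b≢p b≢q =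
    crossᵇ-intro a≢b a≢p a≢q b≢p b≢q (adj⇒≢ G (vertex-adjacent t))

  crossed-by-one-cycle-edge : ∀ {a b t₁ t₂} → T (adj G a b) →
    T (crossᵇ a b (vertex t₁) (vertex (suc t₁))) → T (crossᵇ a b (vertex t₂) (vertex (suc t₂))) → t₁ ≋ t₂
  crossed-by-one-cycle-edge {a} {b} {t₁} {t₂} a~b cross₁ cross₂
    with one-planar a b _ _ _ _ a~b (vertex-adjacent t₁) (vertex-adjacent t₂) cross₁ cross₂
  ... | inj₁ (same , _)       = vertex-injective same
  ... | inj₂ (swap₁ , swap₂) = ⊥-elim (edge-not-reversed 3≤k (vertex-injective swap₁) (vertex-injective swap₂))

  off-cycle-edge-separates-no-cycle-vertices : ∀ {a b r r′} → T (adj G a b) → ¬ T (U a) → ¬ T (U b) →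
    T (U r) → T (U r′) → cyc a b r ≢ cyc a b r′ → ⊥
  off-cycle-edge-separates-no-cycle-vertices {a} {b} a~b a∉U b∉U r∈U r′∈U r|r′
    with ∈U⇒vertex r∈U | ∈U⇒vertex r′∈U
  ... | s , refl | s′ , refl =
    let t₁ , t₂ , t₁≉t₂ , change₁ , change₂ =
          two-side-changes (sides-periodic a b) (λ s≋s′ → r|r′ (cong (cyc a b) (vertex-cong s≋s′))) r|r′
    in t₁≉t₂ (crossed-by-one-cycle-edge a~b (crosses change₁) (crosses change₂))
    where
      crosses : ∀ {t} → SideChange (λ s → cyc a b (vertex s)) t → T (crossᵇ a b (vertex t) (vertex (suc t)))
      crosses {t} = side-change-crosses (adj⇒≢ G a~b)
                      (∉U⇒≢vertex a∉U) (∉U⇒≢vertex a∉U) (∉U⇒≢vertex b∉U) (∉U⇒≢vertex b∉U)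

  vertex-≢ : ∀ {s t} → ¬ s ≋ t → vertex t ≢ vertex s
  vertex-≢ s≉t = s≉t ∘ vertex-injective ∘ ≡.sym

  chord-from-cycle-vertex-crossed : ∀ {a b r r′} → T (U a) → ¬ T (U b) → T (U r) → T (U r′) → r ≢ a → r′ ≢ a →
    cyc a b r ≢ cyc a b r′ → ∃ λ t → a ≢ vertex t × a ≢ vertex (suc t) × T (crossᵇ a b (vertex t) (vertex (suc t)))
  chord-from-cycle-vertex-crossed {b = b} a∈U b∉U r∈U r′∈U r≢a r′≢a r|r′
    with ∈U⇒vertex a∈U | ∈U⇒vertex r∈U | ∈U⇒vertex r′∈U
  ... | j , refl | s , refl | s′ , refl =
    let t , t≉j , t+1≉j , change =
          side-change-avoiding-point (sides-periodic (vertex j) b) j (r≢a ∘ vertex-cong) (r′≢a ∘ vertex-cong) r|r′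
    in t , vertex-≢ t≉j , vertex-≢ t+1≉j ,
       side-change-crosses (λ { refl → b∉U a∈U }) (vertex-≢ t≉j) (vertex-≢ t+1≉j)
         (∉U⇒≢vertex b∉U) (∉U⇒≢vertex b∉U) change

  separating-cycle-edge-crossed : ∀ {t r r′} → T (U r) → T (U r′) →
    r ≢ vertex t → r ≢ vertex (suc t) → r′ ≢ vertex t → r′ ≢ vertex (suc t) →
    cyc (vertex t) (vertex (suc t)) r ≢ cyc (vertex t) (vertex (suc t)) r′ →
    ∃ λ t′ → T (crossᵇ (vertex t) (vertex (suc t)) (vertex t′) (vertex (suc t′)))
  separating-cycle-edge-crossed {t} r∈U r′∈U r≢p r≢q r′≢p r′≢q r|r′ with ∈U⇒vertex r∈U | ∈U⇒vertex r′∈U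
  ... | s , refl | s′ , refl =
    let t′ , (t′≉t , t′≉t+1) , (t′+1≉t , t′+1≉t+1) , change =
          side-change-avoiding-edge (sides-periodic (vertex t) (vertex (suc t))) t
            (r≢p ∘ vertex-cong , r≢q ∘ vertex-cong) (r′≢p ∘ vertex-cong , r′≢q ∘ vertex-cong) r|r′
    in t′ , side-change-crosses (adj⇒≢ G (vertex-adjacent t))
              (vertex-≢ t′≉t) (vertex-≢ t′+1≉t) (vertex-≢ t′≉t+1) (vertex-≢ t′+1≉t+1) change

  module Arc (u w : Fin n) (u∈U : T (U u)) (w∈U : T (U w)) (arc-free : ∀ x → T (cyc u w x) → ¬ T (U x))
    where

    u≢w : u ≢ w
    u≢w refl with vertex 0 ≟ᶠ u
    ... | no  v₀≢u = arc-free (vertex 0) (cyc-full-turn v₀≢u) (vertex-∈U 0)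
    ... | yes refl = arc-free (vertex 1) (cyc-full-turn (≡.≢-sym (adj⇒≢ G (vertex-adjacent 0)))) (vertex-∈U 1)

    endpoint-∈U : ∀ {r} → r ≡ u ⊎ r ≡ w → T (U r)
    endpoint-∈U (inj₁ refl) = u∈U
    endpoint-∈U (inj₂ refl) = w∈U

    endpoint-off-edge : ¬ T (adj G u w) → ∀ {p q} → T (adj G p q) → ∃ λ r → (r ≡ u ⊎ r ≡ w) × r ≢ p × r ≢ q
    endpoint-off-edge u≁w {p} {q} p~q with u ≟ᶠ p | u ≟ᶠ q | w ≟ᶠ p | w ≟ᶠ q
    ... | no u≢p | no u≢q | _        | _        = u , inj₁ refl , u≢p , u≢q
    ... | _      | _      | no w≢p   | no w≢q   = w , inj₂ refl , w≢p , w≢q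
    ... | yes refl | _      | yes w≡u | _       = ⊥-elim (u≢w (≡.sym w≡u))
    ... | _      | yes refl | _        | yes w≡u = ⊥-elim (u≢w (≡.sym w≡u))
    ... | yes refl | _      | _        | yes refl = ⊥-elim (u≁w p~q)
    ... | _      | yes refl | yes refl | _        = ⊥-elim (u≁w (subst T (sym G p q) p~q))

    cycle-edge-separates-from-endpoint : ∀ {t x y r} → T (crossᵇ x y (vertex t) (vertex (suc t))) → T (cyc u w y) →
      r ≡ u ⊎ r ≡ w → r ≢ vertex t → r ≢ vertex (suc t) →
      cyc (vertex t) (vertex (suc t)) x ≢ cyc (vertex t) (vertex (suc t)) r
    cycle-edge-separates-from-endpoint {t} {x} {y} {r} xy⋈pq y∈ r∈uw r≢p r≢q x~r =
      crossᵇ-separates {a = vertex t} {vertex (suc t)} {x} {y} (crossᵇ-sym {a = x} {y} xy⋈pq)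
        (≡.trans x~r (≡.sym (arc-same-side {u = u} {w} {y} {vertex t} {vertex (suc t)} {r}
                               r∈uw (off-arc t) (off-arc (suc t)) y∈ (adj⇒≢ G (vertex-adjacent t)) r≢p r≢q)))
      where
        off-arc : ∀ s → ¬ T (cyc u w (vertex s))
        off-arc s s∈ = arc-free (vertex s) s∈ (vertex-∈U s)

    record OuterNeighbour (x : Fin n) : Set where
      field
        outside : ¬ T (cyc u w x)
        ≢u      : x ≢ u
        ≢w      : x ≢ w
        inner   : Fin n
        inner-∈ : T (cyc u w inner)
        edge    : T (adj G x inner)

    open OuterNeighbour

    inner-∉U : ∀ {x} (o : OuterNeighbour x) → ¬ T (U (inner o))
    inner-∉U o = arc-free (inner o) (inner-∈ o)

    outer-edge-crosses : ∀ {x} (o : OuterNeighbour x) → T (crossᵇ u w x (inner o))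
    outer-edge-crosses o = leaving-arc-crosses (inner-∈ o) (outside o) u≢w (≢u o) (≢w o)

    outer-edge-separates : ∀ {x} (o : OuterNeighbour x) → cyc x (inner o) u ≢ cyc x (inner o) w
    outer-edge-separates {x} o =
      crossᵇ-separates {a = x} {inner o} {u} {w} (crossᵇ-sym {a = u} {w} (outer-edge-crosses o))

    cycle-vertex-not-outer : ¬ T (adj G u w) → ∀ {x} → T (U x) → ¬ OuterNeighbour x
    cycle-vertex-not-outer u≁w {x} x∈U o =
      let t , x≢p , x≢q , xy⋈pq =
            chord-from-cycle-vertex-crossed x∈U (inner-∉U o) u∈U w∈U (≡.≢-sym (≢u o)) (≡.≢-sym (≢w o))
              (outer-edge-separates o)
          r , r∈uw , r≢p , r≢q = endpoint-off-edge u≁w (vertex-adjacent t)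
          t′ , pq⋈e′ = separating-cycle-edge-crossed x∈U (endpoint-∈U r∈uw) x≢p x≢q r≢p r≢q
                         (cycle-edge-separates-from-endpoint xy⋈pq (inner-∈ o) r∈uw r≢p r≢q)
      in [ y-on-cycle ∘ proj₂ , y-on-cycle ∘ proj₂ ]′
           (one-planar _ _ x (inner o) _ _ (vertex-adjacent t) (edge o) (vertex-adjacent t′)
              (crossᵇ-sym {a = x} {inner o} {vertex t} {vertex (suc t)} xy⋈pq) pq⋈e′)
      where
        y-on-cycle : ∀ {s} → inner o ≢ vertex s
        y-on-cycle = ∉U⇒≢vertex (inner-∉U o)

    no-outer-neighbour : ¬ T (adj G u w) → ∀ {x} → ¬ OuterNeighbour x
    no-outer-neighbour u≁w {x} o with T? (U x)
    ... | yes x∈U = cycle-vertex-not-outer u≁w x∈U o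
    ... | no  x∉U = off-cycle-edge-separates-no-cycle-vertices (edge o) x∉U (inner-∉U o) u∈U w∈U
                      (outer-edge-separates o)

    outer-neighbour-unique : ∀ {x x′} → OuterNeighbour x → OuterNeighbour x′ → x ≡ x′
    outer-neighbour-unique {x} {x′} o o′ with T? (adj G u w)
    ... | no  u≁w = ⊥-elim (no-outer-neighbour u≁w o)
    ... | yes u~w =
      [ proj₁ , (λ (x≡y′ , _) → ⊥-elim (outside o (subst (T ∘ cyc u w) (≡.sym x≡y′) (inner-∈ o′)))) ]′
        (one-planar u w x (inner o) x′ (inner o′) u~w (edge o) (edge o′) (outer-edge-crosses o) (outer-edge-crosses o′))

    Boundary : Fin n → Bool
    Boundary x = not (cyc u w x) ∧ any (λ y → cyc u w y ∧ adj G x y) (allFin n)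

    Outerᵇ : Fin n → Bool
    Outerᵇ x = (Boundary x ∧ not ⌊ x ≟ᶠ u ⌋) ∧ not ⌊ x ≟ᶠ w ⌋

    Outerᵇ⇒OuterNeighbour : ∀ {x} → T (Outerᵇ x) → OuterNeighbour x
    Outerᵇ⇒OuterNeighbour {x} outerᵇ =
      let boundary-≢u , x≢w = Equivalence.to T-∧ outerᵇ
          boundary , x≢u    = Equivalence.to T-∧ boundary-≢u
          x∉ , neighbour    = Equivalence.to T-∧ boundary
          y , y∈-adj        = satisfied (any⁻ _ (allFin n) neighbour)
          y∈ , x~y          = Equivalence.to T-∧ y∈-adj
      in record { outside = T-not⁻ x∉ ; ≢u = toWitnessFalse x≢u ; ≢w = toWitnessFalse x≢w
                ; inner = y ; inner-∈ = y∈ ; edge = x~y }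

    boundary-≤3 : boundaryCount G u w ≤ 3
    boundary-≤3 = begin
      length (filterᵇ Boundary (allFin n))
        ≤⟨ length-filterᵇ-remove _≟ᶠ_ (allFin⁺ n) Boundary u ⟩
      1 + length (filterᵇ (λ x → Boundary x ∧ not ⌊ x ≟ᶠ u ⌋) (allFin n))
        ≤⟨ +-monoʳ-≤ 1 (length-filterᵇ-remove _≟ᶠ_ (allFin⁺ n) _ w) ⟩
      2 + length (filterᵇ Outerᵇ (allFin n))
        ≤⟨ +-monoʳ-≤ 2 (length-filterᵇ-≤1 (allFin⁺ n) λ o o′ →
             outer-neighbour-unique (Outerᵇ⇒OuterNeighbour o) (Outerᵇ⇒OuterNeighbour o′)) ⟩
      3 ∎
      where open ≤-Reasoning

corollary1 : ∀ {n} (G : Graph n) → OuterOnePlanar G →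
    (U : Fin n → Bool) (k : ℕ) → 4 ≤ k → InducedCycle G U k →
    ∀ (u w : Fin n) → T (U u) → T (U w) →
    (∀ x → T (cyc u w x) → ¬ T (U x)) →
    boundaryCount G u w ≤ 3
corollary1 G one-planar U k 4≤k (c , c-injective , c-onto , c-adj) u w u∈U w∈U arc-free =
  Arc.boundary-≤3 u w u∈U w∈U arc-free
  where
    open InducedCycleArc G one-planar U k {{>-nonZero (≤-trans (s≤s z≤n) 4≤k)}} (≤-trans (n≤1+n 3) 4≤k)
                         c c-injective c-onto c-adj
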